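{- Let $u,v\in\mathbb{N}\cup\{\omega\}$ and let $B$ be a $u\times v$ matrix with rational entries and finitely many nonzero entries per row. Assume that the kernel $K=\{\vec x\in\mathbb{Q}^v:B\vec x=\vec 0\}$ is nontrivial. Let $V$ be the $\mathbb{Q}$-vector space of all linear maps $K\to\mathbb{Q}$, and for $i<v$ define $\pi_i\in V$ by $\pi_i(\vec x)=x_i$. Let $T\subseteq v$ be maximal subject to $\{\pi_i:i\in T\}$ being linearly independent, and for each $i<v$ choose rationals $\langle d_{i,j}\rangle_{j\in T}$ with $\pi_i=\sum_{j\in T}d_{i,j}\pi_j$. Then: (1) for $i,j\in T$, $d_{i,j}=0$ if $i\neq j$ and $d_{i,i}=1$; (2) if no row of $B$ is identically zero, then for each $k<u$ there is $l\in v\setminus T$ with $b_{k,l}\neq0$; (3) for each $\vec x\in\mathbb{Q}^v$ the following are equivalent: (a) for all $i<v$, $x_i=\sum_{j\in T}d_{i,j}x_j$; (b) for all $i\in v\setminus T$, $x_i=\sum_{j\in T}d_{i,j}x_j$; (c) $\vec x\in K$.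
   Context: $\mathbb{N}$ is the set of positive integers and $\omega=\{0,1,2,\dots\}$; each $u\in\mathbb{N}$ is identified with $\{0,\dots,u-1\}$, and a $u\times v$ matrix has rows indexed by $u$ and columns by $v$. Vectors in $\mathbb{Q}^v$ need not have finitely many nonzero entries; the sums $\sum_{j\in T}$ are in fact finite sums (only finitely many $d_{i,j}$ nonzero for each $i$) as they express a linear combination in $V$. -}

module Defs where

open import Data.Nat using (ℕ)
open import Data.Fin using (Fin)
open import Data.Rational using (ℚ; _+_; _*_; 0ℚ)
open import Data.List using (List; []; _∷_; foldr)
open import Data.List.Relation.Unary.All using (All)
open import Data.List.Relation.Unary.Unique.Propositional using (Unique)
open import Data.List.Membership.Propositional using (_∈_)
open import Data.Product using (Σ; _×_; ∃; ∃-syntax)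
open import Relation.Binary.PropositionalEquality using (_≡_; _≢_)
open import Relation.Nullary using (¬_)

data Card : Set where
  fin : ℕ → Card
  ω   : Card

Ix : Card → Set
Ix (fin n) = Fin n
Ix ω       = ℕ

-- ℚ^v : arbitrary (not necessarily finitely supported) vectors
Vecℚ : Card → Set
Vecℚ v = Ix v → ℚ

sumL : {A : Set} → (A → ℚ) → List A → ℚ
sumL f = foldr (λ a s → f a + s) 0ℚ

record Matrix (u v : Card) : Set where
  field
    entry      : Ix u → Ix v → ℚ
    rowSupp    : Ix u → List (Ix v)
    rowUnique  : ∀ k → Unique (rowSupp k)
    rowCovers  : ∀ k l → entry k l ≢ 0ℚ → l ∈ rowSupp k
open Matrix public

rowApply : ∀ {u v} → Matrix u v → Vecℚ v → Ix u → ℚ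
rowApply B x k = sumL (λ l → entry B k l * x l) (rowSupp B k)

InKer : ∀ {u v} → Matrix u v → Vecℚ v → Set
InKer B x = ∀ k → rowApply B x k ≡ 0ℚ

-- Elements of V are linear maps K → ℚ; equality in V is pointwise on K.
-- The element Σ_{j∈L} c_j π_j of V is the map x ↦ Σ_{j∈L} c_j x_j, so
-- "Σ_{j∈L} c_j π_j = 0 in V" unfolds to the following.
CombZero : ∀ {u v} → Matrix u v → List (Ix v) → (Ix v → ℚ) → Set
CombZero B L c = ∀ x → InKer B x → sumL (λ j → c j * x j) L ≡ 0ℚ

LinIndep : ∀ {u v} → Matrix u v → (Ix v → Set) → Set
LinIndep {v = v} B S = ∀ (L : List (Ix v)) (c : Ix v → ℚ) →
  Unique L → All S L → CombZero B L c → All (λ j → c j ≡ 0ℚ) L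

MaximalIndep : ∀ {u v} → Matrix u v → (Ix v → Set) → Set₁
MaximalIndep {v = v} B T = LinIndep B T ×
  (∀ (S : Ix v → Set) → (∀ i → T i → S i) → LinIndep B S → ∀ i → S i → T i)

KerNontrivial : ∀ {u v} → Matrix u v → Set
KerNontrivial {v = v} B = ∃[ x ] (InKer B x × ∃[ i ] (x i ≢ 0ℚ))

-- d : coefficients ⟨d_{i,j}⟩_{j∈T} for each i<v, finitely many nonzero:
-- dSupp i is a duplicate-free list of elements of T containing every
-- j ∈ T with d i j ≠ 0 (values d i j for j ∉ T are irrelevant).
record Coeffs {v : Card} (T : Ix v → Set) : Set where
  field
    d        : Ix v → Ix v → ℚ
    dSupp    : Ix v → List (Ix v)
    dUnique  : ∀ i → Unique (dSupp i)
    dInT     : ∀ i → All T (dSupp i)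
    dCovers  : ∀ i j → T j → d i j ≢ 0ℚ → j ∈ dSupp i
open Coeffs public

dSum : ∀ {v} {T : Ix v → Set} → Coeffs T → Vecℚ v → Ix v → ℚ
dSum D x i = sumL (λ j → d D i j * x j) (dSupp D i)

Represents : ∀ {u v} → Matrix u v → {T : Ix v → Set} → Coeffs T → Set
Represents B D = ∀ i x → InKer B x → x i ≡ dSum D x i

-- For i ∈ T, both π_i = π_i and π_i = Σ d_ij π_j express π_i over T, so
-- uniqueness of coefficients forces d_ij = δ_ij; this is (1), and it makes the
-- relation for i ∈ T trivial, so (a) ⇔ (b). If x satisfies every relation, then (B x)_k = Σ_j (Σ_l b_kl d_lj) x_j,
-- a combination of the π_j which vanishes on K (K satisfies the relations), so its
-- coefficients vanish and x ∈ K. For (2), a row supported inside T would be a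
-- vanishing combination of independent π_j, hence zero.

module Submission where

open import Defs
open import Data.Rational using (ℚ; 0ℚ; 1ℚ; _+_; _*_; _-_)
import Data.Rational as ℚ
import Data.Rational.Properties as ℚ
open import Data.Rational.Solver using (module +-*-Solver)
open +-*-Solver using (solve; _:+_; _:-_; _:*_; _:=_)
open import Algebra.Properties.Group ℚ.+-0-group using (x∙y⁻¹≈ε⇒x≈y)
open import Data.Bool using (if_then_else_)
open import Data.Empty using (⊥-elim)
open import Data.List using (List; []; _∷_; filter; deduplicate; concatMap)
open import Data.List.Relation.Unary.All as All using (All; []; _∷_)
open import Data.List.Relation.Unary.Any using (here; there; any?; satisfied)
open import Data.List.Membership.Propositional using (_∈_; _∉_; lose; find)
open import Data.List.Membership.Propositional.Properties
  using (∈-filter⁺; ∈-filter⁻; ∈-deduplicate⁺; ∈-deduplicate⁻; ∈-concatMap⁺; ∈-concatMap⁻)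
open import Data.List.Membership.Propositional.Properties.WithK using (unique∧set⇒bag)
open import Data.List.Relation.Unary.Unique.Propositional using (Unique)
open import Data.List.Relation.Unary.AllPairs using ([]; _∷_)
import Data.List.Relation.Unary.Unique.Propositional.Properties as Unique
import Data.List.Relation.Unary.Unique.DecPropositional.Properties as UniqueDec
open import Data.List.Relation.Binary.Permutation.Propositional using (_↭_; refl; prep; swap; trans)
open import Data.List.Relation.Binary.BagAndSetEquality using (∼bag⇒↭)
open import Data.Product using (_×_; _,_; proj₂; ∃-syntax)
import Data.Fin as Fin
import Data.Nat as ℕ
open import Function.Base using (_∘_)
open import Function.Bundles using (_⇔_; mk⇔)
open import Relation.Binary.Definitions using (DecidableEquality)
open import Relation.Binary.PropositionalEquality
  using (_≡_; _≢_; refl; sym; cong; cong₂; module ≡-Reasoning)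
  renaming (trans to ≡-trans)
open import Relation.Nullary using (¬_; yes; no; does; ¬?)
open import Relation.Nullary.Decidable using (decidable-stable; dec-true; dec-false)
open import Relation.Unary using (Decidable)

module _ {A : Set} where

  sumL-cong : ∀ {f g : A → ℚ} L → (∀ {a} → a ∈ L → f a ≡ g a) → sumL f L ≡ sumL g L
  sumL-cong []      f≡g = refl
  sumL-cong (a ∷ L) f≡g = cong₂ _+_ (f≡g (here refl)) (sumL-cong L (f≡g ∘ there))

  sumL-zero : ∀ {f : A → ℚ} L → (∀ {a} → a ∈ L → f a ≡ 0ℚ) → sumL f L ≡ 0ℚ
  sumL-zero []      f≡0 = refl
  sumL-zero (a ∷ L) f≡0 = cong₂ _+_ (f≡0 (here refl)) (sumL-zero L (f≡0 ∘ there))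

  sumL-+ : ∀ (f g : A → ℚ) L → sumL (λ a → f a + g a) L ≡ sumL f L + sumL g L
  sumL-+ f g []      = refl
  sumL-+ f g (a ∷ L) = ≡-trans (cong (f a + g a +_) (sumL-+ f g L))
    (solve 4 (λ p q r s → (p :+ q) :+ (r :+ s) := (p :+ r) :+ (q :+ s)) refl
      (f a) (g a) (sumL f L) (sumL g L))

  sumL-- : ∀ (f g : A → ℚ) L → sumL (λ a → f a - g a) L ≡ sumL f L - sumL g L
  sumL-- f g []      = refl
  sumL-- f g (a ∷ L) = ≡-trans (cong (f a - g a +_) (sumL-- f g L))
    (solve 4 (λ p q r s → (p :- q) :+ (r :- s) := (p :+ r) :- (q :+ s)) refl
      (f a) (g a) (sumL f L) (sumL g L))

  sumL-*ˡ : ∀ q (f : A → ℚ) L → sumL (λ a → q * f a) L ≡ q * sumL f L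
  sumL-*ˡ q f []      = sym (ℚ.*-zeroʳ q)
  sumL-*ˡ q f (a ∷ L) = ≡-trans (cong (q * f a +_) (sumL-*ˡ q f L))
    (sym (ℚ.*-distribˡ-+ q (f a) (sumL f L)))

  sumL-*ʳ : ∀ q (f : A → ℚ) L → sumL (λ a → f a * q) L ≡ sumL f L * q
  sumL-*ʳ q f []      = sym (ℚ.*-zeroˡ q)
  sumL-*ʳ q f (a ∷ L) = ≡-trans (cong (f a * q +_) (sumL-*ʳ q f L))
    (sym (ℚ.*-distribʳ-+ q (f a) (sumL f L)))

  sumL-↭ : ∀ (f : A → ℚ) {L M} → L ↭ M → sumL f L ≡ sumL f M
  sumL-↭ f refl           = refl
  sumL-↭ f (prep a L↭M)   = cong (f a +_) (sumL-↭ f L↭M)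
  sumL-↭ f (swap a b L↭M) = ≡-trans (cong (λ s → f a + (f b + s)) (sumL-↭ f L↭M))
    (solve 3 (λ p q r → p :+ (q :+ r) := q :+ (p :+ r)) refl (f a) (f b) _)
  sumL-↭ f (trans K↭L L↭M) = ≡-trans (sumL-↭ f K↭L) (sumL-↭ f L↭M)

  sumL-filter : ∀ {P : A → Set} (P? : Decidable P) {f : A → ℚ} L →
    (∀ {a} → a ∈ L → ¬ P a → f a ≡ 0ℚ) → sumL f (filter P? L) ≡ sumL f L
  sumL-filter P? []      f≡0 = refl
  sumL-filter P? {f} (a ∷ L) f≡0 with P? a
  ... | yes _  = cong (f a +_) (sumL-filter P? L (f≡0 ∘ there))
  ... | no ¬Pa = begin
    sumL f (filter P? L)       ≡⟨ sumL-filter P? L (f≡0 ∘ there) ⟩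
    sumL f L                   ≡⟨ ℚ.+-identityˡ (sumL f L) ⟨
    0ℚ + sumL f L              ≡⟨ cong (_+ sumL f L) (f≡0 (here refl) ¬Pa) ⟨
    f a + sumL f L             ∎
    where open ≡-Reasoning

sumL-comm : ∀ {A B : Set} (g : A → B → ℚ) L M →
  sumL (λ a → sumL (g a) M) L ≡ sumL (λ b → sumL (λ a → g a b) L) M
sumL-comm g []      M = sym (sumL-zero M (λ _ → refl))
sumL-comm g (a ∷ L) M = ≡-trans (cong (sumL (g a) M +_) (sumL-comm g L M))
  (sym (sumL-+ (g a) (λ b → sumL (λ a → g a b) L) M))


module WithDecidableEquality {A : Set} (_≟_ : DecidableEquality A) where
  open import Data.List.Membership.DecPropositional _≟_ using (_∈?_)

  sumL-support : ∀ {f : A → ℚ} {L M} → Unique L → Unique M →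
    (∀ {a} → a ∈ L → a ∉ M → f a ≡ 0ℚ) → (∀ {a} → a ∈ M → a ∉ L → f a ≡ 0ℚ) →
    sumL f L ≡ sumL f M
  sumL-support {f} {L} {M} !L !M f≡0ᴸ f≡0ᴹ = begin
    sumL f L                   ≡⟨ sumL-filter (_∈? M) L f≡0ᴸ ⟨
    sumL f (filter (_∈? M) L)  ≡⟨ sumL-↭ f (∼bag⇒↭ (unique∧set⇒bag
                                    (Unique.filter⁺ (_∈? M) !L) (Unique.filter⁺ (_∈? L) !M)
                                    (mk⇔ (swap-filter L M) (swap-filter M L)))) ⟩
    sumL f (filter (_∈? L) M)  ≡⟨ sumL-filter (_∈? L) M f≡0ᴹ ⟩
    sumL f M                   ∎
    where
    open ≡-Reasoning
    swap-filter : ∀ K N {a} → a ∈ filter (_∈? N) K → a ∈ filter (_∈? K) N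
    swap-filter K N p = let a∈K , a∈N = ∈-filter⁻ (_∈? N) {xs = K} p in ∈-filter⁺ (_∈? K) a∈N a∈K

  δ : A → A → ℚ
  δ a b = if does (a ≟ b) then 1ℚ else 0ℚ

  δ-refl : ∀ a → δ a a ≡ 1ℚ
  δ-refl a rewrite dec-true (a ≟ a) refl = refl

  δ-≢ : ∀ {a b} → a ≢ b → δ a b ≡ 0ℚ
  δ-≢ {a} {b} a≢b rewrite dec-false (a ≟ b) a≢b = refl

  sumL-δ : ∀ (f : A → ℚ) {a L} → Unique L → a ∈ L → sumL (λ b → δ a b * f b) L ≡ f a
  sumL-δ f {a} {L} !L a∈L = begin
    sumL (λ b → δ a b * f b) L    ≡⟨ sumL-support !L ([] ∷ [])
                                       (λ _ b∉[a] → δ·f≡0 (b∉[a] ∘ here ∘ sym))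
                                       (λ { (here refl) a∉L → ⊥-elim (a∉L a∈L) }) ⟩
    δ a a * f a + 0ℚ              ≡⟨ ℚ.+-identityʳ _ ⟩
    δ a a * f a                   ≡⟨ cong (_* f a) (δ-refl a) ⟩
    1ℚ * f a                      ≡⟨ ℚ.*-identityˡ (f a) ⟩
    f a                           ∎
    where
    open ≡-Reasoning
    δ·f≡0 : ∀ {b} → a ≢ b → δ a b * f b ≡ 0ℚ
    δ·f≡0 {b} a≢b = ≡-trans (cong (_* f b) (δ-≢ a≢b)) (ℚ.*-zeroˡ (f b))

Ix-≟ : ∀ v → DecidableEquality (Ix v)
Ix-≟ (fin n) = Fin._≟_
Ix-≟ ω       = ℕ._≟_

module _ {u v} (B : Matrix u v) where

  support : Ix u → List (Ix v)
  support k = filter (λ l → ¬? (entry B k l ℚ.≟ 0ℚ)) (rowSupp B k)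

  ∈-support⁺ : ∀ {k l} → entry B k l ≢ 0ℚ → l ∈ support k
  ∈-support⁺ {k} b≢0 = ∈-filter⁺ (λ l → ¬? (entry B k l ℚ.≟ 0ℚ)) (rowCovers B k _ b≢0) b≢0

  ∈-support⁻ : ∀ {k l} → l ∈ support k → entry B k l ≢ 0ℚ
  ∈-support⁻ {k} p = proj₂ (∈-filter⁻ (λ l → ¬? (entry B k l ℚ.≟ 0ℚ)) {xs = rowSupp B k} p)

  rowApply-support : ∀ x k → sumL (λ l → entry B k l * x l) (support k) ≡ rowApply B x k
  rowApply-support x k = sumL-filter (λ l → ¬? (entry B k l ℚ.≟ 0ℚ)) (rowSupp B k)
    λ {l} _ ¬b≢0 → ≡-trans (cong (_* x l) (decidable-stable (entry B k l ℚ.≟ 0ℚ) ¬b≢0)) (ℚ.*-zeroˡ (x l))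

module Independent {u v} (B : Matrix u v) {T : Ix v → Set} (indep : LinIndep B T) where

  coefficients-unique : ∀ (c c′ : Ix v → ℚ) {L} → Unique L → All T L →
    (∀ x → InKer B x → sumL (λ j → c j * x j) L ≡ sumL (λ j → c′ j * x j) L) →
    ∀ {j} → j ∈ L → c j ≡ c′ j
  coefficients-unique c c′ {L} !L TL c≡c′ {j} j∈L =
    x∙y⁻¹≈ε⇒x≈y (c j) (c′ j) (All.lookup (indep L (λ j → c j - c′ j) !L TL difference≡0) j∈L)
    where
    difference≡0 : CombZero B L (λ j → c j - c′ j)
    difference≡0 x x∈K = begin
      sumL (λ j → (c j - c′ j) * x j) L
        ≡⟨ sumL-cong L (λ {j} _ → solve 3 (λ p q y → (p :- q) :* y := p :* y :- q :* y) refl (c j) (c′ j) (x j)) ⟩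
      sumL (λ j → c j * x j - c′ j * x j) L
        ≡⟨ sumL-- (λ j → c j * x j) (λ j → c′ j * x j) L ⟩
      sumL (λ j → c j * x j) L - sumL (λ j → c′ j * x j) L
        ≡⟨ cong (_- _) (c≡c′ x x∈K) ⟩
      sumL (λ j → c′ j * x j) L - sumL (λ j → c′ j * x j) L
        ≡⟨ ℚ.+-inverseʳ (sumL (λ j → c′ j * x j) L) ⟩
      0ℚ ∎
      where open ≡-Reasoning

  row-vanishes-if-supported-in-T : ∀ k → (∀ {l} → entry B k l ≢ 0ℚ → T l) → ∀ l → entry B k l ≡ 0ℚ
  row-vanishes-if-supported-in-T k supported l =
    decidable-stable (entry B k l ℚ.≟ 0ℚ) (λ b≢0 → b≢0 (All.lookup row≡0 (∈-support⁺ B b≢0)))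
    where
    row≡0 : All (λ l → entry B k l ≡ 0ℚ) (support B k)
    row≡0 = indep (support B k) (entry B k)
      (Unique.filter⁺ (λ l → ¬? (entry B k l ℚ.≟ 0ℚ)) (rowUnique B k))
      (All.tabulate (supported ∘ ∈-support⁻ B))
      (λ x x∈K → ≡-trans (rowApply-support B x k) (x∈K k))

module Representation {u v} (B : Matrix u v) {T : Ix v → Set} (indep : LinIndep B T)
                      (D : Coeffs T) (rep : Represents B D) where
  open Independent B indep
  open WithDecidableEquality (Ix-≟ v)
  open import Data.List.Membership.DecPropositional (Ix-≟ v) using (_∈?_)

  d-vanishes : ∀ {i j} → T j → j ∉ dSupp D i → d D i j ≡ 0ℚ
  d-vanishes {i} {j} Tj j∉ = decidable-stable (d D i j ℚ.≟ 0ℚ) (j∉ ∘ dCovers D i j Tj)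

  dSum-over : ∀ x i {L} → Unique L → All T L → (∀ {j} → j ∈ dSupp D i → j ∈ L) →
    dSum D x i ≡ sumL (λ j → d D i j * x j) L
  dSum-over x i !L TL dSupp⊆L = sumL-support (dUnique D i) !L
    (λ j∈ j∉ → ⊥-elim (j∉ (dSupp⊆L j∈)))
    (λ {j} j∈L j∉ → ≡-trans (cong (_* x j) (d-vanishes (All.lookup TL j∈L) j∉)) (ℚ.*-zeroˡ (x j)))

  d-on-T : ∀ {i j} → T i → T j → d D i j ≡ δ i j
  d-on-T {i} {j} Ti Tj = coefficients-unique (d D i) (δ i) !L TL same-map (⊆L (there (here refl)))
    where
    L : List (Ix v)
    L = deduplicate (Ix-≟ v) (i ∷ j ∷ dSupp D i)
    ⊆L : ∀ {k} → k ∈ i ∷ j ∷ dSupp D i → k ∈ L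
    ⊆L = ∈-deduplicate⁺ (Ix-≟ v) {xs = i ∷ j ∷ dSupp D i}
    !L : Unique L
    !L = UniqueDec.deduplicate-! (Ix-≟ v) (i ∷ j ∷ dSupp D i)
    TL : All T L
    TL = All.tabulate (All.lookup (Ti ∷ Tj ∷ dInT D i) ∘ ∈-deduplicate⁻ (Ix-≟ v) (i ∷ j ∷ dSupp D i))
    same-map : ∀ x → InKer B x → sumL (λ j → d D i j * x j) L ≡ sumL (λ j → δ i j * x j) L
    same-map x x∈K = begin
      sumL (λ j → d D i j * x j) L  ≡⟨ dSum-over x i !L TL (⊆L ∘ there ∘ there) ⟨
      dSum D x i                    ≡⟨ rep i x x∈K ⟨
      x i                           ≡⟨ sumL-δ x !L (⊆L (here refl)) ⟨
      sumL (λ j → δ i j * x j) L    ∎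
      where open ≡-Reasoning

  -- With dInT, this makes i ∈ dSupp D i a decidable stand-in for the possibly
  -- undecidable T i.
  T⇒∈dSupp : ∀ {i} → T i → i ∈ dSupp D i
  T⇒∈dSupp {i} Ti = dCovers D i i Ti (λ d≡0 → 1≢0 (≡-trans (sym (≡-trans (d-on-T Ti Ti) (δ-refl i))) d≡0))
    where
    1≢0 : 1ℚ ≢ 0ℚ
    1≢0 ()

  dSum-on-T : ∀ {i} → T i → ∀ x → dSum D x i ≡ x i
  dSum-on-T {i} Ti x = ≡-trans
    (sumL-cong (dSupp D i) (λ {j} j∈ → cong (_* x j) (d-on-T Ti (All.lookup (dInT D i) j∈))))
    (sumL-δ x (dUnique D i) (T⇒∈dSupp Ti))

  off-T⇒everywhere : ∀ x → (∀ i → ¬ T i → x i ≡ dSum D x i) → ∀ i → x i ≡ dSum D x i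
  off-T⇒everywhere x off-T i with i ∈? dSupp D i
  ... | yes i∈ = sym (dSum-on-T (All.lookup (dInT D i) i∈) x)
  ... | no  i∉ = off-T i (i∉ ∘ T⇒∈dSupp)

  rowIndices : Ix u → List (Ix v)
  rowIndices k = deduplicate (Ix-≟ v) (concatMap (dSupp D) (rowSupp B k))

  rowCoeff : Ix u → Ix v → ℚ
  rowCoeff k j = sumL (λ l → entry B k l * d D l j) (rowSupp B k)

  rowIndices-unique : ∀ k → Unique (rowIndices k)
  rowIndices-unique k = UniqueDec.deduplicate-! (Ix-≟ v) (concatMap (dSupp D) (rowSupp B k))

  rowIndices-⊆T : ∀ k → All T (rowIndices k)
  rowIndices-⊆T k = All.tabulate λ j∈ →
    let l , j∈dSupp = satisfied (∈-concatMap⁻ (dSupp D) {xs = rowSupp B k}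
                                   (∈-deduplicate⁻ (Ix-≟ v) (concatMap (dSupp D) (rowSupp B k)) j∈))
    in All.lookup (dInT D l) j∈dSupp

  dSupp⊆rowIndices : ∀ {k l j} → l ∈ rowSupp B k → j ∈ dSupp D l → j ∈ rowIndices k
  dSupp⊆rowIndices {k} l∈ j∈ =
    ∈-deduplicate⁺ (Ix-≟ v) (∈-concatMap⁺ (dSupp D) {xs = rowSupp B k} (lose l∈ j∈))

  rowApply-expand : ∀ x → (∀ i → x i ≡ dSum D x i) →
    ∀ k → rowApply B x k ≡ sumL (λ j → rowCoeff k j * x j) (rowIndices k)
  rowApply-expand x expanded k = begin
    sumL (λ l → b l * x l) R
      ≡⟨ sumL-cong R (λ {l} l∈ → cong (b l *_) (≡-trans (expanded l)
           (dSum-over x l (rowIndices-unique k) (rowIndices-⊆T k) (dSupp⊆rowIndices l∈)))) ⟩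
    sumL (λ l → b l * sumL (λ j → d D l j * x j) J) R
      ≡⟨ sumL-cong R (λ {l} _ → sym (sumL-*ˡ (b l) _ J)) ⟩
    sumL (λ l → sumL (λ j → b l * (d D l j * x j)) J) R
      ≡⟨ sumL-comm (λ l j → b l * (d D l j * x j)) R J ⟩
    sumL (λ j → sumL (λ l → b l * (d D l j * x j)) R) J
      ≡⟨ sumL-cong J (λ {j} _ → ≡-trans (sumL-cong R (λ {l} _ → sym (ℚ.*-assoc (b l) (d D l j) (x j))))
                                         (sumL-*ʳ (x j) (λ l → b l * d D l j) R)) ⟩
    sumL (λ j → rowCoeff k j * x j) J ∎
    where
    open ≡-Reasoning
    R = rowSupp B k
    J = rowIndices k
    b = entry B k

  everywhere⇒InKer : ∀ x → (∀ i → x i ≡ dSum D x i) → InKer B x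
  everywhere⇒InKer x expanded k = ≡-trans (rowApply-expand x expanded k)
    (sumL-zero (rowIndices k) (λ {j} j∈ → ≡-trans (cong (_* x j) (All.lookup rowCoeff≡0 j∈)) (ℚ.*-zeroˡ (x j))))
    where
    rowCoeff≡0 : All (λ j → rowCoeff k j ≡ 0ℚ) (rowIndices k)
    rowCoeff≡0 = indep (rowIndices k) (rowCoeff k) (rowIndices-unique k) (rowIndices-⊆T k)
      (λ y y∈K → ≡-trans (sym (rowApply-expand y (λ i → rep i y y∈K) k)) (y∈K k))

  row-meets-complement : ∀ {k l} → entry B k l ≢ 0ℚ → ∃[ l ] (¬ T l × entry B k l ≢ 0ℚ)
  row-meets-complement {k} {l} b≢0 with any? (λ l → ¬? (l ∈? dSupp D l)) (support B k)
  ... | yes found = let l′ , l′∈ , l′∉ = find found in l′ , l′∉ ∘ T⇒∈dSupp , ∈-support⁻ B l′∈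
  ... | no  none  = ⊥-elim (b≢0 (row-vanishes-if-supported-in-T k in-T l))
    where
    in-T : ∀ {l} → entry B k l ≢ 0ℚ → T l
    in-T {l} b≢0 = All.lookup (dInT D l)
      (decidable-stable (l ∈? dSupp D l) (none ∘ lose (∈-support⁺ B b≢0)))

lemma2p2 : (u v : Card) (B : Matrix u v) → KerNontrivial B →
    (T : Ix v → Set) → MaximalIndep B T →
    (D : Coeffs T) → Represents B D →
      (∀ i j → T i → T j → (i ≢ j → d D i j ≡ 0ℚ) × (i ≡ j → d D i j ≡ 1ℚ))
    × ((∀ k → ∃[ l ] (entry B k l ≢ 0ℚ)) → ∀ k → ∃[ l ] (¬ T l × entry B k l ≢ 0ℚ))
    × (∀ (x : Vecℚ v) →
         ((∀ i → x i ≡ dSum D x i) ⇔ (∀ i → ¬ T i → x i ≡ dSum D x i))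
       × ((∀ i → ¬ T i → x i ≡ dSum D x i) ⇔ InKer B x))
lemma2p2 u v B _ T (indep , _) D rep = diagonal , nonzero-rows , characterisation
  where
  open Representation B indep D rep
  open WithDecidableEquality (Ix-≟ v) using (δ-refl; δ-≢)

  diagonal : ∀ i j → T i → T j → (i ≢ j → d D i j ≡ 0ℚ) × (i ≡ j → d D i j ≡ 1ℚ)
  diagonal i j Ti Tj = (λ i≢j → ≡-trans (d-on-T Ti Tj) (δ-≢ i≢j))
                     , (λ { refl → ≡-trans (d-on-T Ti Tj) (δ-refl i) })

  nonzero-rows : (∀ k → ∃[ l ] (entry B k l ≢ 0ℚ)) → ∀ k → ∃[ l ] (¬ T l × entry B k l ≢ 0ℚ)
  nonzero-rows nonzero k = row-meets-complement (proj₂ (nonzero k))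

  characterisation : ∀ x →
      ((∀ i → x i ≡ dSum D x i) ⇔ (∀ i → ¬ T i → x i ≡ dSum D x i))
    × ((∀ i → ¬ T i → x i ≡ dSum D x i) ⇔ InKer B x)
  characterisation x = mk⇔ (λ everywhere i _ → everywhere i) (off-T⇒everywhere x)
                     , mk⇔ (everywhere⇒InKer x ∘ off-T⇒everywhere x) (λ x∈K i _ → rep i x x∈K)
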